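{- Let $G$ be a finite, simple, connected graph which is randomly $k$-dimensional with $k\geq 2$, and let $\delta$ be the minimum degree of $G$. Then $\delta\geq 2$.
   Context: $d(x,y)$ is the distance in $G$. For an ordered set $W=\{w_1,\ldots,w_k\}\subseteq V(G)$ and $v\in V(G)$, $r(v|W)=(d(v,w_1),\ldots,d(v,w_k))$. $W$ is a resolving set if distinct vertices have distinct representations with respect to $W$. The metric dimension $\beta(G)$ is the minimum size of a resolving set; a resolving set of size $\beta(G)$ is a basis. $G$ is randomly $k$-dimensional if $\beta(G)=k$ and every $k$-subset of $V(G)$ is a basis of $G$. -}

module Defs where

open import Data.Nat using (ℕ; zero; suc; _≤_)
open import Data.Bool using (Bool; true; false)
open import Data.Fin using (Fin)
open import Data.Fin.Subset using (Subset; _∈_; ∣_∣)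
open import Data.Vec using (tabulate)
open import Data.Product using (Σ; _×_; ∃)
open import Relation.Binary.PropositionalEquality using (_≡_)
open import Relation.Nullary using (¬_)

record Graph (n : ℕ) : Set where
  field
    adj     : Fin n → Fin n → Bool
    symm    : ∀ x y → adj x y ≡ adj y x
    irrefl  : ∀ x → adj x x ≡ false

open Graph public

module _ {n : ℕ} (G : Graph n) where

  data Walk : Fin n → Fin n → ℕ → Set where
    nil  : ∀ {x} → Walk x x 0
    cons : ∀ {x y z m} → adj G x y ≡ true → Walk y z m → Walk x z (suc m)

  Connected : Set
  Connected = ∀ x y → ∃ λ m → Walk x y m

  IsDist : Fin n → Fin n → ℕ → Set
  IsDist x y m = Walk x y m × (∀ m' → Walk x y m' → m ≤ m')

  SameDist : Fin n → Fin n → Fin n → Set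
  SameDist u v w = ∃ λ m → IsDist u w m × IsDist v w m

  Resolving : Subset n → Set
  Resolving W = ∀ u v → (∀ w → w ∈ W → SameDist u v w) → u ≡ v

  MetricDimension : ℕ → Set
  MetricDimension k =
    (Σ (Subset n) λ W → Resolving W × ∣ W ∣ ≡ k)
    × (∀ W → Resolving W → k ≤ ∣ W ∣)

  RandomlyKDimensional : ℕ → Set
  RandomlyKDimensional k =
    MetricDimension k × (∀ W → ∣ W ∣ ≡ k → Resolving W)

  degree : Fin n → ℕ
  degree v = ∣ tabulate (adj G v) ∣

  MinDegreeAtLeast : ℕ → Set
  MinDegreeAtLeast d = ∀ v → d ≤ degree v

-- A vertex of degree 0 in a connected graph means the graph is a single vertex, whose
-- metric dimension is 0. If v has a unique neighbour u, then every other vertex x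
-- satisfies d(x,v) = d(x,u) + 1, so u is redundant in any resolving set containing v;
-- removing u from a k-subset containing both u and v leaves a resolving set of size k - 1.
module Submission where

open import Defs
open import Data.Nat using (ℕ; zero; suc; _≤_; _<_; _+_; z≤n; s≤s; _≤?_)
open import Data.Nat.Properties
  using (≤-trans; ≤-reflexive; ≤-pred; <⇒≤; <⇒≱; ≤∧≢⇒<; n≤1+n; n≤0⇒n≡0;
         +-suc; +-monoʳ-≤; suc-injective)
  renaming (_≟_ to _≟ℕ_)
open import Data.Bool using (true)
open import Data.Fin using (Fin)
open import Data.Fin.Properties using (_≟_)
open import Data.Fin.Subset using (Subset; _∈_; _⊆_; ∣_∣; _∪_; _-_; ⁅_⁆; ⊥; ⊤; Empty; inside; outside)
open import Data.Fin.Subset.Properties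
  using (∣p∣≤n; ∣p∣≤∣x∷p∣; ∣⊥∣≡0; ∣⊤∣≡n; ⊆⊤; s⊆s; ∣⁅x⁆∣≡1; x∈⁅x⁆; x∈p∪q⁺;
         x≢y⇒x∉⁅y⁆; x∈p∧x∉q⇒x∈p─q; x∈p⇒∣p-x∣<∣p∣; nonempty?)
open import Data.Vec using ([]; _∷_; here; there; tabulate)
open import Data.Vec.Properties using (lookup∘tabulate; []=⇒lookup; lookup⇒[]=)
open import Data.Product using (_×_; _,_; ∃)
open import Data.Sum using (_⊎_; inj₁; inj₂)
open import Function using (_∘_)
open import Relation.Nullary using (¬_; yes; no; contradiction)
open import Relation.Nullary.Decidable using (decidable-stable)
open import Relation.Binary.PropositionalEquality

private
  variable
    n k : ℕ

∣p∪q∣≤∣p∣+∣q∣ : (p q : Subset n) → ∣ p ∪ q ∣ ≤ ∣ p ∣ + ∣ q ∣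
∣p∪q∣≤∣p∣+∣q∣ []             []             = z≤n
∣p∪q∣≤∣p∣+∣q∣ (inside  ∷ p) (inside  ∷ q) = s≤s (≤-trans (∣p∪q∣≤∣p∣+∣q∣ p q) (+-monoʳ-≤ ∣ p ∣ (n≤1+n ∣ q ∣)))
∣p∪q∣≤∣p∣+∣q∣ (inside  ∷ p) (outside ∷ q) = s≤s (∣p∪q∣≤∣p∣+∣q∣ p q)
∣p∪q∣≤∣p∣+∣q∣ (outside ∷ p) (inside  ∷ q) rewrite +-suc ∣ p ∣ ∣ q ∣ = s≤s (∣p∪q∣≤∣p∣+∣q∣ p q)
∣p∪q∣≤∣p∣+∣q∣ (outside ∷ p) (outside ∷ q) = ∣p∪q∣≤∣p∣+∣q∣ p q

x∈p⇒0<∣p∣ : ∀ {p : Subset n} {x} → x ∈ p → 0 < ∣ p ∣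
x∈p⇒0<∣p∣                 here      = s≤s z≤n
x∈p⇒0<∣p∣ {p = s ∷ p} (there x∈p) = ≤-trans (x∈p⇒0<∣p∣ x∈p) (∣p∣≤∣x∷p∣ s p)

x∈p∧x≢y⇒x∈p-y : ∀ {p : Subset n} {x y} → x ∈ p → x ≢ y → x ∈ p - y
x∈p∧x≢y⇒x∈p-y x∈p x≢y = x∈p∧x∉q⇒x∈p─q x∈p (x≢y⇒x∉⁅y⁆ x≢y)

x∈p∧y∈p∧x≢y⇒2≤∣p∣ : ∀ {p : Subset n} {x y} → x ∈ p → y ∈ p → x ≢ y → 2 ≤ ∣ p ∣
x∈p∧y∈p∧x≢y⇒2≤∣p∣ x∈p y∈p x≢y =
  ≤-trans (s≤s (x∈p⇒0<∣p∣ (x∈p∧x≢y⇒x∈p-y y∈p (x≢y ∘ sym)))) (x∈p⇒∣p-x∣<∣p∣ x∈p)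

∣p∣<2∧x∈p∧y∈p⇒x≡y : ∀ {p : Subset n} {x y} → ¬ 2 ≤ ∣ p ∣ → x ∈ p → y ∈ p → x ≡ y
∣p∣<2∧x∈p∧y∈p⇒x≡y {x = x} {y} ∣p∣<2 x∈p y∈p =
  decidable-stable (x ≟ y) (∣p∣<2 ∘ x∈p∧y∈p∧x≢y⇒2≤∣p∣ x∈p y∈p)

mutual
  ⊆-extend : (p : Subset n) → ∣ p ∣ ≤ k → k ≤ n → ∃ λ q → p ⊆ q × ∣ q ∣ ≡ k
  ⊆-extend {n} {k} p ∣p∣≤k k≤n with k ≟ℕ n
  ... | yes refl = ⊤ , ⊆⊤ , ∣⊤∣≡n n
  ... | no k≢n   = ⊆-extend-< p ∣p∣≤k (≤∧≢⇒< k≤n k≢n)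

  ⊆-extend-< : (p : Subset n) → ∣ p ∣ ≤ k → k < n → ∃ λ q → p ⊆ q × ∣ q ∣ ≡ k
  ⊆-extend-< (outside ∷ p) ∣p∣≤k (s≤s k≤n) with ⊆-extend p ∣p∣≤k k≤n
  ... | q , p⊆q , ∣q∣≡k = outside ∷ q , s⊆s p⊆q , ∣q∣≡k
  ⊆-extend-< (inside ∷ p) (s≤s ∣p∣≤k) (s≤s k<n) with ⊆-extend p ∣p∣≤k (<⇒≤ k<n)
  ... | q , p⊆q , ∣q∣≡k = inside ∷ q , s⊆s p⊆q , cong suc ∣q∣≡k

module _ (G : Graph n) where

  private
    variable
      m : ℕ
      x y z u v : Fin n
      W : Subset n

  infix 4 _∼_
  _∼_ : Fin n → Fin n → Set
  x ∼ y = adj G x y ≡ true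

  ∼-sym : x ∼ y → y ∼ x
  ∼-sym {x} {y} x∼y = trans (symm G y x) x∼y

  ∼-irrefl : x ∼ y → x ≢ y
  ∼-irrefl {x} x∼x refl with trans (sym x∼x) (irrefl G x)
  ... | ()

  _∷ʳ_ : Walk G x y m → y ∼ z → Walk G x z (suc m)
  nil            ∷ʳ y∼z = cons y∼z nil
  cons x∼w w⇝y ∷ʳ y∼z = cons x∼w (w⇝y ∷ʳ y∼z)

  reverse : Walk G x y m → Walk G y x m
  reverse nil            = nil
  reverse (cons x∼w w⇝y) = reverse w⇝y ∷ʳ ∼-sym x∼w

  Walk-0⇒≡ : Walk G x y 0 → x ≡ y
  Walk-0⇒≡ nil = refl

  SameDist-sym : SameDist G x y z → SameDist G y x z
  SameDist-sym (m , dx , dy) = m , dy , dx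

  SameDist-self⇒≡ : SameDist G x y x → x ≡ y
  SameDist-self⇒≡ (m , (_ , shortest) , (y⇝x , _)) with n≤0⇒n≡0 (shortest 0 nil)
  ... | refl = sym (Walk-0⇒≡ y⇝x)

  neighbours : Fin n → Subset n
  neighbours v = tabulate (adj G v)

  ∈-neighbours⁺ : v ∼ u → u ∈ neighbours v
  ∈-neighbours⁺ {v} {u} v∼u = lookup⇒[]= u _ (trans (lookup∘tabulate (adj G v) u) v∼u)

  ∈-neighbours⁻ : u ∈ neighbours v → v ∼ u
  ∈-neighbours⁻ {u} {v} u∈N = trans (sym (lookup∘tabulate (adj G v) u)) ([]=⇒lookup u∈N)

  degree<2⇒unique-neighbour : ¬ 2 ≤ degree G v → u ∈ neighbours v → v ∼ y → y ≡ u
  degree<2⇒unique-neighbour deg<2 u∈N v∼y = ∣p∣<2∧x∈p∧y∈p⇒x≡y deg<2 (∈-neighbours⁺ v∼y) u∈N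

  isolated⇒⊥-resolving : Connected G → Empty (neighbours v) → Resolving G ⊥
  isolated⇒⊥-resolving {v} connected isolated x y _ = trans (≡v x) (sym (≡v y))
    where
    ≡v : ∀ y → y ≡ v
    ≡v y with connected v y
    ... | zero  , nil        = refl
    ... | suc _ , cons v∼w _ = contradiction (_ , ∈-neighbours⁺ v∼w) isolated

  module Pendant (v∼u : v ∼ u) (unique : ∀ {y} → v ∼ y → y ≡ u) where

    dist-via-neighbour : x ≢ v → IsDist G x v m → ∃ λ m′ → m ≡ suc m′ × IsDist G x u m′
    dist-via-neighbour x≢v (x⇝v , shortest) with reverse x⇝v
    ... | nil = contradiction refl x≢v
    ... | cons v∼w w⇝x with unique v∼w
    ...   | refl = _ , refl , reverse w⇝x , λ m′ x⇝u → ≤-pred (shortest _ (x⇝u ∷ʳ ∼-sym v∼u))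

    SameDist-pendant : SameDist G x y v → x ≡ y ⊎ SameDist G x y u
    SameDist-pendant {x} {y} sd@(m , dx , dy) with x ≟ v | y ≟ v
    ... | yes refl | _        = inj₁ (SameDist-self⇒≡ sd)
    ... | _        | yes refl = inj₁ (sym (SameDist-self⇒≡ (SameDist-sym sd)))
    ... | no x≢v   | no y≢v with dist-via-neighbour x≢v dx | dist-via-neighbour y≢v dy
    ...   | a , refl , dxu | b , 1+a≡1+b , dyu with suc-injective 1+a≡1+b
    ...     | refl = inj₂ (a , dxu , dyu)

    Resolving-minus-neighbour : Resolving G W → v ∈ W → Resolving G (W - u)
    Resolving-minus-neighbour {W} resolves v∈W x y agree
      with SameDist-pendant (agree v (x∈p∧x≢y⇒x∈p-y v∈W (∼-irrefl v∼u)))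
    ... | inj₁ x≡y    = x≡y
    ... | inj₂ sameAtU = resolves x y agreeOnW
      where
      agreeOnW : ∀ w → w ∈ W → SameDist G x y w
      agreeOnW w w∈W with w ≟ u
      ... | yes refl = sameAtU
      ... | no w≢u   = agree w (x∈p∧x≢y⇒x∈p-y w∈W w≢u)

    smaller-resolving-set : (∀ W → ∣ W ∣ ≡ k → Resolving G W) → 2 ≤ k → k ≤ n →
                            ∃ λ W → Resolving G W × ∣ W ∣ < k
    smaller-resolving-set {k} every 2≤k k≤n with ⊆-extend (⁅ u ⁆ ∪ ⁅ v ⁆) ∣⁅u⁆∪⁅v⁆∣≤k k≤n
      where
      ∣⁅u⁆∪⁅v⁆∣≤k : ∣ ⁅ u ⁆ ∪ ⁅ v ⁆ ∣ ≤ k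
      ∣⁅u⁆∪⁅v⁆∣≤k = ≤-trans (∣p∪q∣≤∣p∣+∣q∣ ⁅ u ⁆ ⁅ v ⁆)
                            (≤-trans (≤-reflexive (cong₂ _+_ (∣⁅x⁆∣≡1 u) (∣⁅x⁆∣≡1 v))) 2≤k)
    ... | T , uv⊆T , ∣T∣≡k =
      T - u ,
      Resolving-minus-neighbour (every T ∣T∣≡k) (uv⊆T (x∈p∪q⁺ (inj₂ (x∈⁅x⁆ v)))) ,
      subst (∣ T - u ∣ <_) ∣T∣≡k (x∈p⇒∣p-x∣<∣p∣ (uv⊆T (x∈p∪q⁺ (inj₁ (x∈⁅x⁆ u)))))

mainTheorem3 : ∀ {n : ℕ} (G : Graph n) (k : ℕ) →
    Connected G → RandomlyKDimensional G k → 2 ≤ k →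
    MinDegreeAtLeast G 2
mainTheorem3 {n} G k connected (((W₀ , _ , ∣W₀∣≡k) , minimal) , every) 2≤k v
  with 2 ≤? degree G v
... | yes 2≤deg = 2≤deg
... | no deg<2 with nonempty? (neighbours G v)
...   | no isolated =
  contradiction (≤-trans 2≤k (≤-trans (minimal ⊥ (isolated⇒⊥-resolving G connected isolated))
                                      (≤-reflexive (∣⊥∣≡0 n))))
                λ ()
...   | yes (u , u∈N)
  with Pendant.smaller-resolving-set G (∈-neighbours⁻ G u∈N) (degree<2⇒unique-neighbour G deg<2 u∈N)
         every 2≤k (subst (_≤ n) ∣W₀∣≡k (∣p∣≤n W₀))
...     | W , resolves , ∣W∣<k = contradiction (minimal W resolves) (<⇒≱ ∣W∣<k)
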